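{- Let $L_0$ be a logic, $L$ an extension of $L_0$, and $F\dashv G$ the associated Galois connection. Let $T_0$ be a theory of $L_0$ and $T=F(T_0)$. If $T_0$ is Hilbert-Post complete (in $L_0$) and $T$ is Hilbert-Post complete with respect to $L_0$, then $T$ is Hilbert-Post complete (in $L$).
   Context: A logic consists of a language (a set of formulas) together with deduction rules. A theory of a logic is a set of formulas which is deductively closed: every formula derivable from it using the rules already belongs to it. Theories are ordered by inclusion. In a given logic, $T_{\max}$ denotes the maximal theory (all formulas); a theory $T$ is consistent if $T\neq T_{\max}$, and it is Hilbert-Post complete if it is consistent and every theory containing $T$ is equal either to $T$ or to $T_{\max}$. For theories $T,T'$, $T+T'$ denotes the theory generated by $T\cup T'$. $L$ is an extension of $L_0$: formulas of $L_0$ are formulas of $L$. For a theory $T_0$ of $L_0$, $F(T_0)$ is the theory of $L$ generated by $T_0$; for a theory $T$ of $L$, $G(T)$ is the theory of $L_0$ consisting of the theorems of $T$ that are formulas of $L_0$. $F$ and $G$ are monotone and $F(T_0)\subseteq T$ iff $T_0\subseteq G(T)$. A theory $T'$ of $L$ is $L_0$-derivable from a theory $T$ of $L$ if $T'=T+F(T'_0)$ for some theory $T'_0$ of $L_0$. A theory $T$ of $L$ is Hilbert-Post complete with respect to $L_0$ if it is consistent and every theory of $L$ containing $T$ is $L_0$-derivable from $T$. -}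

module Defs where

open import Data.List using (List; map)
open import Data.List.Relation.Unary.All using (All)
open import Data.Product using (Σ; ∃; _×_; _,_)
open import Data.Sum using (_⊎_)
open import Data.Unit using (⊤)
open import Relation.Nullary using (¬_)
open import Relation.Binary.PropositionalEquality using (_≡_)

record Logic : Set₁ where
  field
    Form : Set
    Rule : List Form → Form → Set

FSet : Logic → Set₁
FSet L = Logic.Form L → Set

Sub : (L : Logic) → FSet L → FSet L → Set
Sub L S S' = ∀ (φ : Logic.Form L) → S φ → S' φ

Eq : (L : Logic) → FSet L → FSet L → Set
Eq L S S' = Sub L S S' × Sub L S' S

data Deriv (L : Logic) (S : FSet L) : Logic.Form L → Set where
  hyp  : ∀ {φ} → S φ → Deriv L S φ
  rule : ∀ {ps φ} → Logic.Rule L ps φ → All (Deriv L S) ps → Deriv L S φ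

Gen : (L : Logic) → FSet L → FSet L
Gen L S = Deriv L S

IsTheory : (L : Logic) → FSet L → Set
IsTheory L T = ∀ {ps φ} → Logic.Rule L ps φ → All T ps → T φ

Tmax : (L : Logic) → FSet L
Tmax L _ = ⊤

Consistent : (L : Logic) → FSet L → Set
Consistent L T = ¬ Eq L T (Tmax L)

-- union of sets of formulas;  T + T' = Plus L T T' = Gen L (T ∪ T')
Union : (L : Logic) → FSet L → FSet L → FSet L
Union L S S' φ = S φ ⊎ S' φ

Plus : (L : Logic) → FSet L → FSet L → FSet L
Plus L T T' = Gen L (Union L T T')

HilbertPostComplete : (L : Logic) → FSet L → Set₁
HilbertPostComplete L T =
  IsTheory L T × Consistent L T ×
  (∀ (T' : FSet L) → IsTheory L T' → Sub L T T' → Eq L T' T ⊎ Eq L T' (Tmax L))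

record Extension (L0 L : Logic) : Set where
  field
    ι : Logic.Form L0 → Logic.Form L
    ruleIncl : ∀ {ps φ} → Logic.Rule L0 ps φ → Logic.Rule L (map ι ps) (ι φ)

module _ {L0 L : Logic} (E : Extension L0 L) where
  open Extension E

  Img : FSet L0 → FSet L
  Img S0 φ = Σ (Logic.Form L0) (λ ψ → S0 ψ × (ι ψ ≡ φ))

  F : FSet L0 → FSet L
  F T0 = Gen L (Img T0)

  G : FSet L → FSet L0
  G T ψ = T (ι ψ)

  L0Derivable : FSet L → FSet L → Set₁
  L0Derivable T T' = Σ (FSet L0) (λ T'0 → IsTheory L0 T'0 × Eq L T' (Plus L T (F T'0)))

  HPCwrt : FSet L → Set₁
  HPCwrt T = Consistent L T ×
    (∀ (T' : FSet L) → IsTheory L T' → Sub L T T' → L0Derivable T T')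

-- Let T' ⊇ T = F(T₀) be a theory of L. By completeness with respect to L₀,
-- T' = T + F(T'₀) for some theory T'₀ of L₀, and by completeness of T₀ the
-- L₀-theory T₀ + T'₀ is either T₀ or everything. In the first case T'₀ ⊆ T₀,
-- so F(T'₀) ⊆ T and T' = T. In the second case G(T') contains T₀ and T'₀, hence
-- every L₀-formula; then any L₀-derivable extension of T, in particular T_max,
-- lies inside T'.
module Submission where

open import Defs
open import Data.Product using (_,_)
open import Data.Sum using (_⊎_; inj₁; inj₂; [_,_])
open import Data.Unit using (tt)
open import Data.List.Relation.Unary.All using (All; []; _∷_)
open import Data.List.Relation.Unary.All.Properties using (map⁺)
open import Relation.Binary.PropositionalEquality using (refl)

module _ {L : Logic} where

  Gen-isTheory : (S : FSet L) → IsTheory L (Gen L S)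
  Gen-isTheory S = rule

  module _ {S T : FSet L} (isT : IsTheory L T) (S⊆T : Sub L S T) where
    mutual
      Gen-least : Sub L (Gen L S) T
      Gen-least φ (hyp s)     = S⊆T φ s
      Gen-least φ (rule r ds) = isT r (Gen-least-All ds)

      Gen-least-All : ∀ {ps} → All (Deriv L S) ps → All T ps
      Gen-least-All []       = []
      Gen-least-All (d ∷ ds) = Gen-least _ d ∷ Gen-least-All ds

  Plus-⊇ˡ : (T T' : FSet L) → Sub L T (Plus L T T')
  Plus-⊇ˡ T T' φ t = hyp (inj₁ t)

  Plus-⊇ʳ : (T T' : FSet L) → Sub L T' (Plus L T T')
  Plus-⊇ʳ T T' φ t = hyp (inj₂ t)

  Plus-least : {T T' U : FSet L} → IsTheory L U →
               Sub L T U → Sub L T' U → Sub L (Plus L T T') U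
  Plus-least isU T⊆U T'⊆U = Gen-least isU (λ φ → [ T⊆U φ , T'⊆U φ ])

module _ {L0 L : Logic} (E : Extension L0 L) where
  open Extension E

  G-isTheory : {T : FSet L} → IsTheory L T → IsTheory L0 (G E T)
  G-isTheory {T} isT r ts = isT (ruleIncl r) (map⁺ {P = T} ts)

  F⊆⇒⊆G : {S0 : FSet L0} {T : FSet L} → Sub L (F E S0) T → Sub L0 S0 (G E T)
  F⊆⇒⊆G F⊆T ψ s = F⊆T (ι ψ) (hyp (ψ , s , refl))

  ⊆G⇒F⊆ : {S0 : FSet L0} {T : FSet L} → IsTheory L T →
           Sub L0 S0 (G E T) → Sub L (F E S0) T
  ⊆G⇒F⊆ isT S0⊆GT = Gen-least isT λ { _ (ψ , s , refl) → S0⊆GT ψ s }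

  F-mono : {S0 S0' : FSet L0} → Sub L0 S0 S0' → Sub L (F E S0) (F E S0')
  F-mono S0⊆S0' = ⊆G⇒F⊆ (Gen-isTheory _) (λ ψ s → hyp (ψ , S0⊆S0' ψ s , refl))

  L0Derivable-⊆ : {T T' T'' : FSet L} → IsTheory L T' → Sub L T T' →
                  (∀ ψ → G E T' ψ) → L0Derivable E T T'' → Sub L T'' T'
  L0Derivable-⊆ isT' T⊆T' allL0 (_ , _ , T''⊆P , _) φ t =
    Plus-least isT' T⊆T' (⊆G⇒F⊆ isT' (λ ψ _ → allL0 ψ)) φ (T''⊆P φ t)

theorem2p6 : (L0 L : Logic) (E : Extension L0 L) (T0 : FSet L0) →
    IsTheory L0 T0 →
    HilbertPostComplete L0 T0 →
    HPCwrt E (F E T0) →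
    HilbertPostComplete L (F E T0)
theorem2p6 L0 L E T0 _ (_ , _ , complete0) (consistent , derivable) =
  Gen-isTheory _ , consistent , complete
  where
  T = F E T0

  complete : ∀ T' → IsTheory L T' → Sub L T T' → Eq L T' T ⊎ Eq L T' (Tmax L)
  complete T' isT' T⊆T' with derivable T' isT' T⊆T'
  ... | T'0 , _ , T'⊆P , P⊆T'
      with complete0 (Plus L0 T0 T'0) (Gen-isTheory _) (Plus-⊇ˡ T0 T'0)
  ... | inj₁ (U0⊆T0 , _) =
    inj₁ ((λ φ t → Plus-least (Gen-isTheory _) (λ _ t → t) FT'0⊆T φ (T'⊆P φ t)) , T⊆T')
    where
    FT'0⊆T : Sub L (F E T'0) T
    FT'0⊆T = F-mono E (λ ψ t → U0⊆T0 ψ (Plus-⊇ʳ T0 T'0 ψ t))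
  ... | inj₂ (_ , all⊆U0) =
    inj₂ ((λ _ _ → tt) ,
          L0Derivable-⊆ E isT' T⊆T' allL0 (derivable (Tmax L) (λ _ _ → tt) (λ _ _ → tt)))
    where
    U0⊆GT' : Sub L0 (Plus L0 T0 T'0) (G E T')
    U0⊆GT' = Plus-least (G-isTheory E isT') (F⊆⇒⊆G E T⊆T')
               (F⊆⇒⊆G E (λ φ t → P⊆T' φ (Plus-⊇ʳ T _ φ t)))
    allL0 : ∀ ψ → G E T' ψ
    allL0 ψ = U0⊆GT' ψ (all⊆U0 ψ tt)
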